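{- Let $G$ be a simple cubic graph with a polyhedral embedding $\Pi$. Let $\mathcal P=(t_0,t_1,\dots,t_n)$ and $\mathcal Q=(q_0,q_1,\dots,q_m)$ be internally disjoint paths with $q_0=t_0$ and $q_m=t_n$, both of which are $\Pi$-facial subwalks, and suppose $t_0t_n\notin E(G)$. Then the cycle $\mathcal P\cup\mathcal Q$ is a $\Pi$-facial cycle.
   Context: An embedding of a graph in a surface without boundary is polyhedral if every facial walk (boundary walk of a face) is a cycle and any two distinct facial cycles intersect in either the empty set, a single vertex, or a single edge. A $\Pi$-facial subwalk is a walk formed by consecutive vertices of some $\Pi$-facial cycle (in either direction). -}

module Defs where

open import Data.Nat using (ℕ; suc; _≤_)
open import Data.Fin using (Fin)
open import Data.List using (List; []; _∷_; _++_; [_]; zip; length; reverse)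
open import Data.List.Membership.Propositional using (_∈_)
open import Data.List.Relation.Unary.Unique.Propositional using (Unique)
open import Data.List.Relation.Unary.Linked using (Linked)
open import Data.Product using (Σ; ∃; ∃-syntax; _×_; _,_)
open import Data.Sum using (_⊎_)
open import Relation.Nullary using (¬_)
open import Relation.Binary.PropositionalEquality using (_≡_; _≢_)
open import Relation.Binary.Construct.Closure.ReflexiveTransitive using (Star)
open import Relation.Binary.Construct.Closure.Symmetric using (SymClosure)
open import Function.Bundles using (_⇔_)

record Graph (n : ℕ) : Set₁ where
  field
    Adj     : Fin n → Fin n → Set
    sym     : ∀ {x y} → Adj x y → Adj y x
    irrefl  : ∀ {x} → ¬ Adj x x
open Graph public

module _ {n : ℕ} (G : Graph n) where

  Cubic : Set
  Cubic = ∀ v → Σ (Fin n) λ a → Σ (Fin n) λ b → Σ (Fin n) λ c →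
            a ≢ b × a ≢ c × b ≢ c ×
            (∀ w → Adj G v w ⇔ (w ≡ a ⊎ w ≡ b ⊎ w ≡ c))

  Connected : Set
  Connected = ∀ u v → Star (Adj G) u v

-- A closed walk / cycle is written as a list of vertices, read cyclically.
-- Cyclically consecutive ordered pairs (x_i , x_{i+1}), including (last , first).
pairs : {A : Set} → List A → List (A × A)
pairs []       = []
pairs (x ∷ xs) = zip (x ∷ xs) (xs ++ [ x ])

Consec : {A : Set} → List A → A → A → Set
Consec f x y = (x , y) ∈ pairs f

OnEdge : {A : Set} → List A → A → A → Set
OnEdge f x y = Consec f x y ⊎ Consec f y x

SameCycle : {A : Set} → List A → List A → Set
SameCycle {A} f c = Σ (List A) λ a → Σ (List A) λ b →
  f ≡ a ++ b × (c ≡ b ++ a ⊎ reverse c ≡ b ++ a)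

module _ {n : ℕ} (G : Graph n) where

  IsCycle : List (Fin n) → Set
  IsCycle f = 3 ≤ length f × Unique f × (∀ x y → Consec f x y → Adj G x y)

  IsPath : List (Fin n) → Set
  IsPath p = Unique p × Linked (Adj G) p

  -- A polyhedral embedding of G in a closed surface, given combinatorially by
  -- its system of facial cycles (faces indexed by Fin nf).
  record PolyhedralEmbedding : Set where
    field
      nf    : ℕ
      face  : Fin nf → List (Fin n)
      faceCycle : ∀ i → IsCycle (face i)
      edgeTwice : ∀ x y → Adj G x y →
        Σ (Fin nf) λ i → Σ (Fin nf) λ j → i ≢ j ×
          OnEdge (face i) x y × OnEdge (face j) x y ×
          (∀ k → OnEdge (face k) x y → k ≡ i ⊎ k ≡ j)
      -- the faces around each vertex form a single disk (vertex link connected)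
      linkConnected : ∀ v x y → Adj G v x → Adj G v y →
        Star (SymClosure (λ a b → ∃[ i ] (Consec (face i) a v × Consec (face i) v b))) x y
      polyhedral : ∀ i j → i ≢ j →
        (∀ w → ¬ (w ∈ face i × w ∈ face j))
        ⊎ (∃[ v ] (∀ w → (w ∈ face i × w ∈ face j) ⇔ (w ≡ v)))
        ⊎ (∃[ x ] ∃[ y ] (OnEdge (face i) x y × OnEdge (face j) x y ×
             (∀ w → (w ∈ face i × w ∈ face j) ⇔ (w ≡ x ⊎ w ≡ y))))
  open PolyhedralEmbedding public

  module _ (Π : PolyhedralEmbedding) where
    FacialSubwalk : List (Fin n) → Set
    FacialSubwalk p = ∃[ i ] (Linked (Consec (face Π i)) p ⊎ Linked (Consec (face Π i)) (reverse p))

    FacialCycle : List (Fin n) → Set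
    FacialCycle c = ∃[ i ] SameCycle (face Π i) c

module Submission where

-- Each path runs along some face, forwards or backwards.  If the two
-- faces were distinct, both would contain the distinct vertices s and e; in a
-- polyhedral embedding two distinct faces share at most one vertex or one edge, so
-- s e would be an edge, contrary to hypothesis.  Hence both paths run along the same
-- face F, whose vertex sequence is duplicate-free.  On a duplicate-free cyclic
-- sequence every vertex has a unique successor, so two walks leaving the same vertex
-- in the same direction start with the same vertex; for the two internally disjoint
-- paths this is impossible.  So the paths traverse F in opposite directions, and
-- glued together they form a closed walk along F visiting no vertex twice, which
-- must be a rotation of F itself.

open import Defs hiding (sym)
open import Data.Nat using (ℕ)
open import Data.Fin using (Fin; _≟_)
open import Data.List using (List; []; _∷_; _++_; [_]; reverse; zip)
open import Data.List.Membership.Propositional using (_∈_; _∉_)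
open import Data.List.Membership.Propositional.Properties using (∈-∃++; ∈-++⁺ʳ)
open import Data.List.Relation.Unary.Any using (here; there)
open import Data.List.Relation.Unary.Any.Properties using (reverse⁻)
open import Data.List.Relation.Unary.All as All using (All; _∷_)
open import Data.List.Relation.Unary.All.Properties using (All¬⇒¬Any; ++⁺; ++⁻ˡ; ++⁻ʳ)
open import Data.List.Relation.Unary.AllPairs using (_∷_)
open import Data.List.Relation.Unary.Unique.Propositional using (Unique)
open import Data.List.Relation.Unary.Linked as Linked using (Linked; [-]; _∷_)
open import Data.List.Relation.Binary.Permutation.Propositional using (↭⇒↭ₛ; ↭-sym)
open import Data.List.Relation.Binary.Permutation.Propositional.Properties
  using (++-comm; ∈-resp-↭; All-resp-↭; ↭-reverse)
import Data.List.Relation.Binary.Permutation.Setoid.Properties as PermutationProperties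
open import Data.List.Properties using (++-assoc; ++-identityʳ; reverse-++; unfold-reverse; reverse-involutive)
open import Data.Product as Product using (Σ; _×_; _,_; proj₁; proj₂)
open import Data.Sum using (_⊎_; inj₁; inj₂)
open import Data.Empty using (⊥-elim)
open import Function using (_∘_)
open import Function.Bundles using (Equivalence)
open import Relation.Nullary using (¬_; yes; no)
open import Relation.Binary.PropositionalEquality
  using (_≡_; _≢_; refl; sym; trans; cong; subst; setoid)
open Relation.Binary.PropositionalEquality.≡-Reasoning

private
  variable
    A : Set
    R : A → A → Set
    h u v x y z : A
    c t w : List A

steps : List A → List (A × A)
steps (x ∷ y ∷ r) = (x , y) ∷ steps (y ∷ r)
steps _           = []

zip-as-steps : (x : A) (xs : List A) (y : A) →
               zip (x ∷ xs) (xs ++ [ y ]) ≡ steps (x ∷ xs ++ [ y ])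
zip-as-steps x []       y = refl
zip-as-steps x (z ∷ zs) y = cong ((x , z) ∷_) (zip-as-steps z zs y)

step-middle : (a : List A) → (x , z) ∈ steps (a ++ x ∷ z ∷ c)
step-middle []          = here refl
step-middle (u ∷ [])    = there (here refl)
step-middle (u ∷ v ∷ a) = there (step-middle (v ∷ a))

step-prefix : {p : A × A} (l m : List A) → p ∈ steps l → p ∈ steps (l ++ m)
step-prefix (u ∷ v ∷ l) m (here eq) = here eq
step-prefix (u ∷ v ∷ l) m (there q) = there (step-prefix (v ∷ l) m q)

step⇒consec : {p : A × A} (h : A) (t : List A) → p ∈ steps (h ∷ t) → p ∈ pairs (h ∷ t)
step⇒consec h t q = subst (_ ∈_) (sym (zip-as-steps h t h)) (step-prefix (h ∷ t) [ h ] q)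

consec-middle : (a : List A) → Consec (a ++ x ∷ z ∷ c) x z
consec-middle []      = step⇒consec _ _ (here refl)
consec-middle (u ∷ a) = step⇒consec u _ (step-middle (u ∷ a))

consec-at : {f : List A} (a : List A) → f ≡ a ++ x ∷ z ∷ c → Consec f x z
consec-at a refl = consec-middle a

consec-wrap : (h : A) (a : List A) → Consec (h ∷ a ++ [ x ]) x h
consec-wrap {x = x} h a =
  subst ((x , h) ∈_) (sym (zip-as-steps h (a ++ [ x ]) h))
    (subst (λ l → (x , h) ∈ steps (h ∷ l)) (sym (++-assoc a [ x ] [ h ])) (step-middle (h ∷ a)))

zip-∈ : {l m : List A} → (x , y) ∈ zip l m → x ∈ l × y ∈ m
zip-∈ {l = a ∷ l} {m = b ∷ m} (here refl) = here refl , here refl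
zip-∈ {l = a ∷ l} {m = b ∷ m} (there q)   = Product.map there there (zip-∈ q)

consec-∈ : {f : List A} → Consec f x y → x ∈ f × y ∈ f
consec-∈ {f = h ∷ t} c = Product.map₂ (∈-resp-↭ (++-comm t [ h ])) (zip-∈ c)

zip-functional : {l m : List A} → Unique l →
                 (x , y) ∈ zip l m → (x , z) ∈ zip l m → y ≡ z
zip-functional {l = a ∷ l} {m = b ∷ m} _         (here refl) (here refl) = refl
zip-functional {l = a ∷ l} {m = b ∷ m} (a∉ ∷ _) (here refl) (there q)   =
  ⊥-elim (All.lookup a∉ (proj₁ (zip-∈ q)) refl)
zip-functional {l = a ∷ l} {m = b ∷ m} (a∉ ∷ _) (there q)   (here refl) =
  ⊥-elim (All.lookup a∉ (proj₁ (zip-∈ q)) refl)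
zip-functional {l = a ∷ l} {m = b ∷ m} (_ ∷ ul) (there q)   (there r)   = zip-functional ul q r

consec-functional : {f : List A} → Unique f → Consec f x y → Consec f x z → y ≡ z
consec-functional {f = h ∷ t} = zip-functional

consec-rotate-one : (x : A) (xs : List A) → Consec (x ∷ xs) u v → Consec (xs ++ [ x ]) u v
consec-rotate-one x []       c           = c
consec-rotate-one x (y ∷ ys) (here refl) = consec-wrap y ys
consec-rotate-one x (y ∷ ys) (there q)   =
  step⇒consec y (ys ++ [ x ]) (subst (_ ∈_) (zip-as-steps y ys x) q)

consec-rotate : (a b : List A) → Consec (a ++ b) u v → Consec (b ++ a) u v
consec-rotate {u = u} {v} [] b c = subst (λ l → Consec l u v) (sym (++-identityʳ b)) c
consec-rotate {u = u} {v} (x ∷ a) b c =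
  subst (λ l → Consec l u v) (++-assoc b [ x ] a)
    (consec-rotate a (b ++ [ x ])
      (subst (λ l → Consec l u v) (++-assoc a b [ x ]) (consec-rotate-one x (a ++ b) c)))

unique-rotate : (a b : List A) → Unique (a ++ b) → Unique (b ++ a)
unique-rotate {A} a b = PermutationProperties.Unique-resp-↭ (setoid A) (↭⇒↭ₛ (++-comm a b))

Rotation : List A → List A → Set
Rotation {A} f c = Σ (List A) λ a → Σ (List A) λ b → f ≡ a ++ b × c ≡ b ++ a

rotation-step : {f : List A} → Rotation f (x ∷ w) → Rotation f (w ++ [ x ])
rotation-step {x = x} {w} (a , [] , f≡a , refl) = [ x ] , w , trans f≡a (++-identityʳ (x ∷ w)) , refl
rotation-step (a , y ∷ b , refl , refl) = a ++ [ y ] , b , sym (++-assoc a [ y ] b) , ++-assoc b a [ y ]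

Along : List A → List A → Set
Along f = Linked (Consec f)

EitherWay : List A → List A → Set
EitherWay f w = Along f w ⊎ Along f (reverse w)

reverse-walk : (x : A) (l : List A) (y : A) → reverse (x ∷ l ++ [ y ]) ≡ y ∷ reverse l ++ [ x ]
reverse-walk x l y = trans (unfold-reverse x (l ++ [ y ])) (cong (_++ [ x ]) (reverse-++ l [ y ]))

orient : {f : List A} (l : List A) → EitherWay f (x ∷ l ++ [ y ]) →
         Along f (x ∷ l ++ [ y ]) ⊎ Along f (y ∷ reverse l ++ [ x ])
orient l (inj₁ forwards)  = inj₁ forwards
orient {f = f} l (inj₂ backwards) = inj₂ (subst (Along f) (reverse-walk _ l _) backwards)

walk-endpoints : {f : List A} (l : List A) → Along f (x ∷ l ++ [ y ]) → x ∈ f × y ∈ f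
walk-endpoints []      (c ∷ _)  = consec-∈ c
walk-endpoints {f = f} (u ∷ l) (c ∷ walk) = proj₁ (consec-∈ c) , proj₂ (walk-endpoints {f = f} l walk)

either-way-endpoints : {f : List A} (l : List A) → EitherWay f (x ∷ l ++ [ y ]) → x ∈ f × y ∈ f
either-way-endpoints {f = f} l walk with orient {f = f} l walk
... | inj₁ forwards  = walk-endpoints {f = f} l forwards
... | inj₂ backwards = Product.swap (walk-endpoints {f = f} (reverse l) backwards)

glue : (xs : List A) → Linked R (xs ++ [ y ]) → Linked R (y ∷ t) → Linked R (xs ++ y ∷ t)
glue []            _           second = second
glue (x ∷ [])      (r ∷ [-])   second = r ∷ second
glue (x ∷ x′ ∷ xs) (r ∷ first) second = r ∷ glue (x′ ∷ xs) first second

head-not-repeated : (a : List A) → Unique (h ∷ t) → h ∷ t ≢ a ++ u ∷ h ∷ c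
head-not-repeated []      (h∉t ∷ _) refl = All.head h∉t refl
head-not-repeated (x ∷ a) (h∉t ∷ _) refl = All.lookup h∉t (∈-++⁺ʳ a (there (here refl))) refl

consec-last : (a : List A) → h ∷ t ≡ a ++ [ u ] → Consec (h ∷ t) u h
consec-last []      refl = here refl
consec-last (x ∷ a) refl = consec-wrap x a

follow-to-start : (pre rest : List A) → Unique (h ∷ t) → h ∷ t ≡ pre ++ u ∷ rest →
                  Along (h ∷ t) (u ∷ w ++ [ h ]) → h ∉ w → w ≡ rest
follow-to-start {w = []} pre [] _ _ _ _ = refl
follow-to-start {w = []} pre (z ∷ rest) uf eq (c ∷ _) _
  with consec-functional uf c (consec-at pre eq)
... | refl = ⊥-elim (head-not-repeated pre uf eq)
follow-to-start {w = y ∷ w} pre [] uf eq (c ∷ _) h∉ =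
  ⊥-elim (h∉ (here (consec-functional uf (consec-last pre eq) c)))
follow-to-start {w = y ∷ w} pre (z ∷ rest) uf eq (c ∷ walk) h∉
  with consec-functional uf c (consec-at pre eq)
... | refl = cong (y ∷_) (follow-to-start (pre ++ [ _ ]) rest uf
                (trans eq (sym (++-assoc pre [ _ ] (y ∷ rest)))) walk (h∉ ∘ there))

closed-walk-is-rotation : {f : List A} → Unique f → (w : List A) →
                          Along f (x ∷ w ++ [ x ]) → x ∉ w → Rotation f (x ∷ w)
closed-walk-is-rotation {x = x} {f} uf w walk x∉w
  with ∈-∃++ (proj₁ (walk-endpoints w walk))
... | a , c , f≡a++xc = a , x ∷ c , f≡a++xc , cong (x ∷_) w≡ca
  where
    rotated : Along (x ∷ c ++ a) (x ∷ w ++ [ x ])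
    rotated = Linked.map (λ {u} {v} step →
                consec-rotate a (x ∷ c) (subst (λ l → Consec l u v) f≡a++xc step)) walk
    w≡ca : w ≡ c ++ a
    w≡ca = follow-to-start [] (c ++ a) (unique-rotate a (x ∷ c) (subst Unique f≡a++xc uf))
             refl rotated x∉w

reverse-head : (p : A) (P : List A) →
               Σ A λ r → Σ (List A) λ rs → reverse (p ∷ P) ≡ r ∷ rs × r ∈ p ∷ P
reverse-head p P with reverse P in eq
... | []     = p , [] , trans (unfold-reverse p P) (cong (_++ [ p ]) eq) , here refl
... | r ∷ rs = r , rs ++ [ p ] , trans (unfold-reverse p P) (cong (_++ [ p ]) eq) ,
               there (reverse⁻ (subst (r ∈_) (sym eq) (here refl)))

reverse-cycle : (s e : A) (X Y : List A) →
                reverse (s ∷ X ++ e ∷ reverse Y) ≡ (Y ++ e ∷ reverse X) ++ [ s ]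
reverse-cycle s e X Y = begin
  reverse (s ∷ X ++ e ∷ reverse Y)              ≡⟨ unfold-reverse s (X ++ e ∷ reverse Y) ⟩
  reverse (X ++ e ∷ reverse Y) ++ [ s ]         ≡⟨ cong (_++ [ s ]) (reverse-++ X (e ∷ reverse Y)) ⟩
  (reverse (e ∷ reverse Y) ++ reverse X) ++ [ s ]
    ≡⟨ cong (λ l → (l ++ reverse X) ++ [ s ])
         (trans (unfold-reverse e (reverse Y)) (cong (_++ [ e ]) (reverse-involutive Y))) ⟩
  ((Y ++ [ e ]) ++ reverse X) ++ [ s ]          ≡⟨ cong (_++ [ s ]) (++-assoc Y [ e ] (reverse X)) ⟩
  (Y ++ e ∷ reverse X) ++ [ s ]                 ∎

start-avoided : {s e : A} (X Y : List A) → All (s ≢_) (X ++ [ e ]) → All (s ≢_) (Y ++ [ e ]) →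
                s ∉ X ++ e ∷ reverse Y
start-avoided X Y avoidX avoidY =
  All¬⇒¬Any (++⁺ (++⁻ˡ X avoidX)
                 (All.head (++⁻ʳ X avoidX) ∷ All-resp-↭ (↭-sym (↭-reverse Y)) (++⁻ˡ Y avoidY)))

opposite-walks-rotation : {f : List A} {s e : A} (X Y : List A) → Unique f →
  All (s ≢_) (X ++ [ e ]) → All (s ≢_) (Y ++ [ e ]) →
  Along f (s ∷ X ++ [ e ]) → Along f (e ∷ reverse Y ++ [ s ]) → Rotation f (s ∷ X ++ e ∷ reverse Y)
opposite-walks-rotation {f = f} {s} {e} X Y uf avoidX avoidY forwards backwards =
  closed-walk-is-rotation uf (X ++ e ∷ reverse Y)
    (subst (λ l → Along f (s ∷ l)) (sym (++-assoc X (e ∷ reverse Y) [ s ])) (glue (s ∷ X) forwards backwards))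
    (start-avoided X Y avoidX avoidY)

first-step-into : {f : List A} (p : A) (P : List A) → Along f (x ∷ reverse (p ∷ P) ++ [ y ]) →
                  Σ A λ r → r ∈ p ∷ P × Consec f x r
first-step-into {x = x} {y} {f} p P walk with reverse-head p P
... | r , rs , reversed , r∈ = r , r∈ , Linked.head (subst (λ l → Along f (x ∷ l ++ [ y ])) reversed walk)

-- Walks
-- in the same direction would share their first inner vertex, the successor of s (or
-- of e); walks in opposite directions glue to a closed walk around f.
two-walks-form-cycle : {f : List A} {s e p q : A} (P Q : List A) → Unique f →
  All (s ≢_) (p ∷ P ++ [ e ]) → All (s ≢_) (q ∷ Q ++ [ e ]) →
  (∀ w → ¬ (w ∈ p ∷ P × w ∈ q ∷ Q)) →
  EitherWay f (s ∷ p ∷ P ++ [ e ]) → EitherWay f (s ∷ q ∷ Q ++ [ e ]) →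
  SameCycle f (s ∷ p ∷ P ++ e ∷ reverse (q ∷ Q))
two-walks-form-cycle {f = f} {s} {e} {p} {q} P Q uf avoidP avoidQ disjoint walkP walkQ
  with orient {f = f} (p ∷ P) walkP | orient {f = f} (q ∷ Q) walkQ
... | inj₁ (s→p ∷ _) | inj₁ (s→q ∷ _) =
  ⊥-elim (disjoint p (here refl , subst (_∈ q ∷ Q) (consec-functional uf s→q s→p) (here refl)))
... | inj₂ backP | inj₂ backQ with first-step-into {f = f} p P backP | first-step-into {f = f} q Q backQ
...   | r , r∈P , e→r | r′ , r′∈Q , e→r′ =
  ⊥-elim (disjoint r (r∈P , subst (_∈ q ∷ Q) (consec-functional uf e→r′ e→r) r′∈Q))
two-walks-form-cycle {f = f} P Q uf avoidP avoidQ disjoint walkP walkQ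
  | inj₁ forwardP | inj₂ backQ
  with opposite-walks-rotation {f = f} (_ ∷ P) (_ ∷ Q) uf avoidP avoidQ forwardP backQ
... | a , b , f≡ab , rotated = a , b , f≡ab , inj₁ rotated
two-walks-form-cycle {f = f} {s} {e} {p} {q} P Q uf avoidP avoidQ disjoint walkP walkQ
  | inj₂ backP | inj₁ forwardQ
  with rotation-step (opposite-walks-rotation {f = f} (q ∷ Q) (p ∷ P) uf avoidQ avoidP forwardQ backP)
... | a , b , f≡ab , rotated = a , b , f≡ab , inj₂ (trans (reverse-cycle s e (p ∷ P) (q ∷ Q)) rotated)

module _ {N : ℕ} {G : Graph N} (Π : PolyhedralEmbedding G) where

  face-edge-adjacent : ∀ i {x y} → OnEdge (face Π i) x y → Adj G x y
  face-edge-adjacent i (inj₁ step) = proj₂ (proj₂ (faceCycle Π i)) _ _ step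
  face-edge-adjacent i (inj₂ step) = Graph.sym G (proj₂ (proj₂ (faceCycle Π i)) _ _ step)

  shared-vertices-adjacent : ∀ {i j} {x y : Fin N} → i ≢ j → x ≢ y →
    x ∈ face Π i → x ∈ face Π j → y ∈ face Π i → y ∈ face Π j → Adj G x y
  shared-vertices-adjacent {i} {j} {x} {y} i≢j x≢y xi xj yi yj with polyhedral Π i j i≢j
  ... | inj₁ disjoint = ⊥-elim (disjoint x (xi , xj))
  ... | inj₂ (inj₁ (v , meet)) =
    ⊥-elim (x≢y (trans (Equivalence.to (meet x) (xi , xj)) (sym (Equivalence.to (meet y) (yi , yj)))))
  ... | inj₂ (inj₂ (a , b , ab-on-i , _ , meet))
    with Equivalence.to (meet x) (xi , xj) | Equivalence.to (meet y) (yi , yj)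
  ...   | inj₁ refl | inj₁ refl = ⊥-elim (x≢y refl)
  ...   | inj₂ refl | inj₂ refl = ⊥-elim (x≢y refl)
  ...   | inj₁ refl | inj₂ refl = face-edge-adjacent i ab-on-i
  ...   | inj₂ refl | inj₁ refl = Graph.sym G (face-edge-adjacent i ab-on-i)

-- The proposition.  Both paths have inner
-- vertices since s e is not an edge.
proposition8 : {N : ℕ} (G : Graph N) → Cubic G → Connected G →
    (Π : PolyhedralEmbedding G) →
    (s e : Fin N) (Pint Qint : List (Fin N)) →
    IsPath G (s ∷ Pint ++ [ e ]) → IsPath G (s ∷ Qint ++ [ e ]) →
    (∀ w → ¬ (w ∈ Pint × w ∈ Qint)) →
    FacialSubwalk G Π (s ∷ Pint ++ [ e ]) → FacialSubwalk G Π (s ∷ Qint ++ [ e ]) →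
    ¬ Adj G s e →
    FacialCycle G Π (s ∷ Pint ++ e ∷ reverse Qint)
proposition8 G _ _ Π s e [] _ (_ , s~e) _ _ _ _ s≁e = ⊥-elim (s≁e (Linked.head s~e))
proposition8 G _ _ Π s e (_ ∷ _) [] _ (_ , s~e) _ _ _ s≁e = ⊥-elim (s≁e (Linked.head s~e))
proposition8 G _ _ Π s e (p ∷ P) (q ∷ Q) (avoidP ∷ _ , _) (avoidQ ∷ _ , _) disjoint
             (i , walkP) (j , walkQ) s≁e with i ≟ j
... | yes refl = i , two-walks-form-cycle P Q (proj₁ (proj₂ (faceCycle Π i))) avoidP avoidQ disjoint walkP walkQ
... | no i≢j = ⊥-elim (s≁e (shared-vertices-adjacent Π i≢j s≢e
                 (proj₁ ends-i) (proj₁ ends-j) (proj₂ ends-i) (proj₂ ends-j)))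
  where
    s≢e : s ≢ e
    s≢e = All.head (++⁻ʳ (p ∷ P) avoidP)
    ends-i : s ∈ face Π i × e ∈ face Π i
    ends-i = either-way-endpoints (p ∷ P) walkP
    ends-j : s ∈ face Π j × e ∈ face Π j
    ends-j = either-way-endpoints (q ∷ Q) walkQ
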